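{- For all $n\ge1$, $a_{\{0102,0121\}}(n)=\frac12\left(3\cdot2^n-n^2-n-2\right)$.
   Context: An ascent in an integer sequence $s_1\cdots s_m$ is an index $j$ with $s_j<s_{j+1}$; $\mathrm{asc}(s)$ is the number of ascents. An ascent sequence is a sequence $x_1\cdots x_n$ of nonnegative integers with $x_1=0$ and $x_i\le 1+\mathrm{asc}(x_1\cdots x_{i-1})$ for $i\ge2$. For a sequence $w$, $\mathrm{red}(w)$ replaces the $i$-th smallest distinct letter of $w$ by $i-1$. A pattern (e.g. $0102$, meaning the sequence $(0,1,0,2)$) is a sequence equal to its reduction. A sequence $x$ contains pattern $p=p_1\cdots p_k$ if there are indices $i_1<\cdots<i_k$ with $\mathrm{red}(x_{i_1}\cdots x_{i_k})=p$; otherwise it avoids $p$. For a set of patterns $P$, $\mathcal A_n(P)$ is the set of ascent sequences of length $n$ avoiding every pattern in $P$, and $a_P(n)=|\mathcal A_n(P)|$. -}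

module Defs where

open import Data.Nat using (ℕ; zero; suc; _<ᵇ_; _≡ᵇ_; _+_)
open import Data.Bool using (Bool; true; false; _∧_; _∨_; not; if_then_else_)
open import Data.List using (List; []; _∷_; length; map; filterᵇ; upTo; concatMap; _++_)
open import Data.Bool.ListAction using (any; all)
open import Relation.Binary.PropositionalEquality using (_≡_)

eqList : List ℕ → List ℕ → Bool
eqList [] [] = true
eqList (x ∷ xs) (y ∷ ys) = (x ≡ᵇ y) ∧ eqList xs ys
eqList _ _ = false

asc : List ℕ → ℕ
asc [] = 0
asc (x ∷ []) = 0
asc (x ∷ y ∷ s) = (if x <ᵇ y then 1 else 0) + asc (y ∷ s)

elem : ℕ → List ℕ → Bool
elem x = any (λ y → x ≡ᵇ y)

distinct : List ℕ → List ℕ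
distinct [] = []
distinct (x ∷ xs) = let d = distinct xs in if elem x d then d else x ∷ d

rank : List ℕ → ℕ → ℕ
rank w x = length (filterᵇ (λ y → y <ᵇ x) (distinct w))

-- red(w): the i-th smallest distinct letter is replaced by i-1,
-- i.e. each letter x is replaced by the number of distinct letters smaller than x
red : List ℕ → List ℕ
red w = map (rank w) w

subseqs : List ℕ → List (List ℕ)
subseqs [] = [] ∷ []
subseqs (x ∷ xs) = let s = subseqs xs in s ++ map (x ∷_) s

contains : List ℕ → List ℕ → Bool
contains x p = any (λ s → eqList (red s) p) (subseqs x)

avoidsAll : List (List ℕ) → List ℕ → Bool
avoidsAll P x = all (λ p → not (contains x p)) P

ascentCond : List ℕ → List ℕ → Bool
ascentCond pre [] = true
ascentCond pre (x ∷ xs) = (x <ᵇ 2 + asc pre) ∧ ascentCond (pre ++ x ∷ []) xs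

isAscentSeq : List ℕ → Bool
isAscentSeq [] = true
isAscentSeq (x ∷ xs) = (x ≡ᵇ 0) ∧ ascentCond (x ∷ []) xs

words : ℕ → ℕ → List (List ℕ)
words m zero = [] ∷ []
words m (suc n) = concatMap (λ x → map (x ∷_) (words m n)) (upTo m)

-- 𝒜_n : ascent sequences of length n (every letter of such a sequence is < n,
-- since x_i ≤ 1 + asc(x₁⋯x_{i-1}) ≤ i - 1; words enumerates each list once)
ascentSeqs : ℕ → List (List ℕ)
ascentSeqs n = filterᵇ isAscentSeq (words n n)

aP : List (List ℕ) → ℕ → ℕ
aP P n = length (filterᵇ (avoidsAll P) (ascentSeqs n))

-- An ascent sequence avoids 0102 and 0121 exactly when it is a binary word 0w or has the
-- form 0⁺1⁺⋯m⁺0* with m ≥ 2: once 0 1 0 has been read, any letter ≥ 2 completes 0102; once a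
-- letter ≥ 2 has been read, revisiting a nonzero letter below the maximum completes 0121; and
-- the ascent condition lets the maximum grow by at most one at a time.  These words are those
-- accepted by an automaton whose states record the shape of the prefix read so far.  Counting
-- accepted words letter by letter gives recurrences solved by 2ᵏ for binary tails and 2ᵏ⁺¹ − 1
-- for staircases; summing them yields the formula.

module Submission where

open import Defs
open import Data.Bool using (Bool; true; false; T; _∧_; _∨_; if_then_else_)
open import Data.Bool.Properties using (T-∧; T-≡; T?)
open import Data.Empty using (⊥)
open import Data.Unit using (⊤)
open import Data.List using (List; []; _∷_; [_]; length; map; filterᵇ; upTo; applyUpTo; concatMap; _++_)
open import Data.List.Properties
  using (map-∘; map-cong; length-map; length-++; filter-++; filter-none; filter-≐; ++-assoc; map-applyUpTo)
open import Data.List.Membership.Propositional using (_∈_; find; lose)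
open import Data.List.Membership.Propositional.Properties
  using (∈-++⁺ˡ; ∈-++⁺ʳ; ∈-++⁻; ∈-map⁺; ∈-map⁻; ∈-filter⁺; ∈-filter⁻)
open import Data.List.Relation.Binary.Pointwise using (≡⇒Pointwise-≡; []; _∷_)
open import Data.List.Relation.Binary.Sublist.Propositional
  using (_⊆_; []; _∷_; _∷ʳ_; ⊆-refl; ⊆-trans; minimum)
open import Data.List.Relation.Binary.Sublist.Propositional.Properties
  using (filter⁺; length-mono-≤; to-≋; ∷ˡ⁻; ++⁺; ++⁺ʳ; All-resp-⊆)
open import Data.List.Relation.Binary.Equality.Propositional using (≋⇒≡)
open import Data.List.Relation.Unary.All using (All; []; _∷_; universal)
open import Data.List.Relation.Unary.Any using (here; there)
import Data.List.Relation.Unary.Any as Any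
open import Data.List.Relation.Unary.Any.Properties using (any⁺; any⁻)
open import Data.Nat
open import Data.Nat.ListAction using (sum)
open import Data.Nat.Solver using (module +-*-Solver)
open +-*-Solver using (solve; _:+_; _:*_; _:=_; con)
open import Data.Nat.Properties
open import Data.Product using (_×_; _,_; proj₁; proj₂; ∃-syntax)
open import Data.Sum using (_⊎_; inj₁; inj₂; [_,_]′)
open import Function using (_∘_; Equivalence)
open import Relation.Binary.Core using (_Preserves_⟶_)
open import Relation.Binary.Definitions using (tri<; tri≈; tri>)
open import Relation.Binary.PropositionalEquality
  using (_≡_; _≢_; refl; sym; trans; cong; cong₂; subst; module ≡-Reasoning)
open import Relation.Nullary using (¬_; contradiction)
open import Relation.Nullary.Reflects using (Reflects; ofʸ; ofⁿ; det; fromEquivalence; T-reflects; _×-reflects_)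
open import Relation.Nullary.Decidable using (decidable-stable)

private
  variable
    A B : Set
    a b c x y : ℕ
    xs ys s w : List ℕ

filterᵇ-map : ∀ (p : B → Bool) (f : A → B) xs → filterᵇ p (map f xs) ≡ map f (filterᵇ (p ∘ f) xs)
filterᵇ-map p f [] = refl
filterᵇ-map p f (x ∷ xs) with p (f x)
... | true  = cong (f x ∷_) (filterᵇ-map p f xs)
... | false = filterᵇ-map p f xs

filterᵇ-cong : ∀ {p q : A → Bool} → (∀ x → p x ≡ q x) → ∀ xs → filterᵇ p xs ≡ filterᵇ q xs
filterᵇ-cong {p = p} {q} p≗q =
  filter-≐ (T? ∘ p) (T? ∘ q) ((λ {x} → subst T (p≗q x)) , (λ {x} → subst T (sym (p≗q x))))

filterᵇ-filterᵇ : ∀ (p q : A → Bool) xs →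
  filterᵇ p (filterᵇ q xs) ≡ filterᵇ (λ x → q x ∧ p x) xs
filterᵇ-filterᵇ p q [] = refl
filterᵇ-filterᵇ p q (x ∷ xs) with q x
... | false = filterᵇ-filterᵇ p q xs
... | true with p x
...   | true  = cong (x ∷_) (filterᵇ-filterᵇ p q xs)
...   | false = filterᵇ-filterᵇ p q xs

length-filterᵇ-concatMap : ∀ (p : B → Bool) (f : A → List B) xs →
  length (filterᵇ p (concatMap f xs)) ≡ sum (map (length ∘ filterᵇ p ∘ f) xs)
length-filterᵇ-concatMap p f []       = refl
length-filterᵇ-concatMap p f (x ∷ xs) = begin
  length (filterᵇ p (f x ++ concatMap f xs))
    ≡⟨ cong length (filter-++ (T? ∘ p) (f x) (concatMap f xs)) ⟩
  length (filterᵇ p (f x) ++ filterᵇ p (concatMap f xs))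
    ≡⟨ length-++ (filterᵇ p (f x)) ⟩
  length (filterᵇ p (f x)) + length (filterᵇ p (concatMap f xs))
    ≡⟨ cong (_ +_) (length-filterᵇ-concatMap p f xs) ⟩
  length (filterᵇ p (f x)) + sum (map (length ∘ filterᵇ p ∘ f) xs) ∎
  where open ≡-Reasoning

≡ᵇ-reflects-≡ : ∀ m n → Reflects (m ≡ n) (m ≡ᵇ n)
≡ᵇ-reflects-≡ m n = fromEquivalence (≡ᵇ⇒≡ m n) (≡⇒≡ᵇ m n)

-- Reduction and ranks

module _ {f : ℕ → ℕ} (f-mono : f Preserves _<_ ⟶ _<_) where

  strictMono-cancel-< : f x < f y → x < y
  strictMono-cancel-< {x} {y} fx<fy with <-cmp x y
  ... | tri< x<y _ _ = x<y
  ... | tri≈ _ refl _ = contradiction fx<fy (<-irrefl refl)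
  ... | tri> _ _ y<x = contradiction (f-mono y<x) (<⇒≯ fx<fy)

  strictMono-injective : f x ≡ f y → x ≡ y
  strictMono-injective {x} {y} fx≡fy with <-cmp x y
  ... | tri< x<y _ _ = contradiction fx≡fy (<⇒≢ (f-mono x<y))
  ... | tri≈ _ x≡y _ = x≡y
  ... | tri> _ _ y<x = contradiction (sym fx≡fy) (<⇒≢ (f-mono y<x))

  <ᵇ-relabel : ∀ x y → (f x <ᵇ f y) ≡ (x <ᵇ y)
  <ᵇ-relabel x y =
    det (fromEquivalence (strictMono-cancel-< ∘ <ᵇ⇒< _ _) (<⇒<ᵇ ∘ f-mono)) (<ᵇ-reflects-< x y)

  ≡ᵇ-relabel : ∀ x y → (f x ≡ᵇ f y) ≡ (x ≡ᵇ y)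
  ≡ᵇ-relabel x y =
    det (fromEquivalence (strictMono-injective ∘ ≡ᵇ⇒≡ _ _) (≡⇒≡ᵇ _ _ ∘ cong f)) (≡ᵇ-reflects-≡ x y)

  elem-relabel : ∀ x ys → elem (f x) (map f ys) ≡ elem x ys
  elem-relabel x [] = refl
  elem-relabel x (y ∷ ys) = cong₂ _∨_ (≡ᵇ-relabel x y) (elem-relabel x ys)

  distinct-relabel : ∀ w → distinct (map f w) ≡ map f (distinct w)
  distinct-relabel [] = refl
  distinct-relabel (x ∷ w) rewrite distinct-relabel w | elem-relabel x (distinct w) with elem x (distinct w)
  ... | true  = refl
  ... | false = refl

  rank-relabel : ∀ w x → rank (map f w) (f x) ≡ rank w x
  rank-relabel w x = begin
    length (filterᵇ (_<ᵇ f x) (distinct (map f w)))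
      ≡⟨ cong (length ∘ filterᵇ (_<ᵇ f x)) (distinct-relabel w) ⟩
    length (filterᵇ (_<ᵇ f x) (map f (distinct w)))
      ≡⟨ cong length (filterᵇ-map (_<ᵇ f x) f (distinct w)) ⟩
    length (map f (filterᵇ (λ y → f y <ᵇ f x) (distinct w)))
      ≡⟨ length-map f (filterᵇ _ (distinct w)) ⟩
    length (filterᵇ (λ y → f y <ᵇ f x) (distinct w))
      ≡⟨ cong length (filterᵇ-cong (λ y → <ᵇ-relabel y x) (distinct w)) ⟩
    length (filterᵇ (_<ᵇ x) (distinct w)) ∎
    where open ≡-Reasoning

  red-relabel : ∀ w → red (map f w) ≡ red w
  red-relabel w = begin
    map (rank (map f w)) (map f w)  ≡⟨ sym (map-∘ w) ⟩
    map (rank (map f w) ∘ f) w      ≡⟨ map-cong (rank-relabel w) w ⟩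
    map (rank w) w                  ∎
    where open ≡-Reasoning

below-⊆ : x ≤ y → ∀ ys → filterᵇ (_<ᵇ x) ys ⊆ filterᵇ (_<ᵇ y) ys
below-⊆ {x} {y} x≤y ys =
  filter⁺ (T? ∘ (_<ᵇ x)) (T? ∘ (_<ᵇ y)) (λ { refl t → <⇒<ᵇ (<-≤-trans (<ᵇ⇒< _ _ t) x≤y) })
          (⊆-refl {x = ys})

elem⇒∈ : T (elem x ys) → x ∈ ys
elem⇒∈ t = Any.map (≡ᵇ⇒≡ _ _) (any⁻ _ _ t)

∈-distinct⁺ : x ∈ w → x ∈ distinct w
∈-distinct⁺ {w = y ∷ w} (here refl) with elem y (distinct w) in e
... | true  = elem⇒∈ (Equivalence.from T-≡ e)
... | false = here refl
∈-distinct⁺ {w = y ∷ w} (there x∈w) with elem y (distinct w)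
... | true  = ∈-distinct⁺ x∈w
... | false = there (∈-distinct⁺ x∈w)

rank-mono-≤ : ∀ w → x ≤ y → rank w x ≤ rank w y
rank-mono-≤ w x≤y = length-mono-≤ (below-⊆ x≤y (distinct w))

rank-mono-< : ∀ w → x ∈ w → x < y → rank w x < rank w y
rank-mono-< {x} {y} w x∈w x<y = ≤∧≢⇒< (rank-mono-≤ w (<⇒≤ x<y)) ranks-differ
  where
  below-x⊆below-y : filterᵇ (_<ᵇ x) (distinct w) ⊆ filterᵇ (_<ᵇ y) (distinct w)
  below-x⊆below-y = below-⊆ (<⇒≤ x<y) (distinct w)

  x∈below-y : x ∈ filterᵇ (_<ᵇ y) (distinct w)
  x∈below-y = ∈-filter⁺ (T? ∘ (_<ᵇ y)) (∈-distinct⁺ x∈w) (<⇒<ᵇ x<y)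

  -- Equal lengths force the sublist of letters below x to be all letters below y, x included.
  ranks-differ : rank w x ≢ rank w y
  ranks-differ eq with ∈-filter⁻ (T? ∘ (_<ᵇ x)) {xs = distinct w}
                         (subst (x ∈_) (sym (≋⇒≡ (to-≋ eq below-x⊆below-y))) x∈below-y)
  ... | _ , x<ᵇx = <-irrefl refl (<ᵇ⇒< x x x<ᵇx)

rank-cancel-< : ∀ w → rank w x < rank w y → x < y
rank-cancel-< w r< = ≰⇒> (λ y≤x → <⇒≱ r< (rank-mono-≤ w y≤x))

rank-injective : ∀ w → x ∈ w → y ∈ w → rank w x ≡ rank w y → x ≡ y
rank-injective {x} {y} w x∈w y∈w eq with <-cmp x y
... | tri< x<y _ _ = contradiction eq (<⇒≢ (rank-mono-< w x∈w x<y))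
... | tri≈ _ x≡y _ = x≡y
... | tri> _ _ y<x = contradiction (sym eq) (<⇒≢ (rank-mono-< w y∈w y<x))

ranks⇒< : ∀ w {i j} → rank w x ≡ i → rank w y ≡ j → i < j → x < y
ranks⇒< w refl refl = rank-cancel-< w

-- Occurrences of the two patterns

p0102 p0121 : List ℕ
p0102 = 0 ∷ 1 ∷ 0 ∷ 2 ∷ []
p0121 = 0 ∷ 1 ∷ 2 ∷ 1 ∷ []

data Shape0102 : List ℕ → Set where
  shape0102 : a < b → b < c → Shape0102 (a ∷ b ∷ a ∷ c ∷ [])

data Shape0121 : List ℕ → Set where
  shape0121 : a < b → b < c → Shape0121 (a ∷ b ∷ c ∷ b ∷ [])

spread : ℕ → ℕ → ℕ → ℕ → ℕ
spread a b c 0             = a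
spread a b c 1             = b
spread a b c (suc (suc k)) = k + c

spread-mono : a < b → b < c → spread a b c Preserves _<_ ⟶ _<_
spread-mono a<b b<c {0}           {1}           _ = a<b
spread-mono a<b b<c {0}           {suc (suc l)} _ = <-≤-trans (<-trans a<b b<c) (m≤n+m _ l)
spread-mono a<b b<c {1}           {suc (suc l)} _ = <-≤-trans b<c (m≤n+m _ l)
spread-mono a<b b<c {suc (suc k)} {suc (suc l)} (s≤s (s≤s k<l)) = +-monoˡ-< _ k<l
spread-mono a<b b<c {1}           {1}           (s≤s ())
spread-mono a<b b<c {suc (suc k)} {1}           (s≤s ())

red-0102 : Shape0102 s → red s ≡ p0102
red-0102 (shape0102 a<b b<c) = red-relabel (spread-mono a<b b<c) p0102

red-0121 : Shape0121 s → red s ≡ p0121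
red-0121 (shape0121 a<b b<c) = red-relabel (spread-mono a<b b<c) p0121

red≡0102⇒shape : ∀ s → red s ≡ p0102 → Shape0102 s
red≡0102⇒shape s@(a ∷ b ∷ a′ ∷ c ∷ []) eq with ≡⇒Pointwise-≡ eq
... | ra ∷ rb ∷ ra′ ∷ rc ∷ [] =
  subst (λ a″ → Shape0102 (a ∷ b ∷ a″ ∷ c ∷ []))
        (rank-injective s (here refl) (there (there (here refl))) (trans ra (sym ra′)))
        (shape0102 (ranks⇒< s ra rb z<s) (ranks⇒< s rb rc (s<s z<s)))
red≡0102⇒shape (_ ∷ _ ∷ _ ∷ _ ∷ _ ∷ _) eq with ≡⇒Pointwise-≡ eq
... | _ ∷ _ ∷ _ ∷ _ ∷ ()
red≡0102⇒shape [] ()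
red≡0102⇒shape (_ ∷ []) ()
red≡0102⇒shape (_ ∷ _ ∷ []) ()
red≡0102⇒shape (_ ∷ _ ∷ _ ∷ []) ()

red≡0121⇒shape : ∀ s → red s ≡ p0121 → Shape0121 s
red≡0121⇒shape s@(a ∷ b ∷ c ∷ b′ ∷ []) eq with ≡⇒Pointwise-≡ eq
... | ra ∷ rb ∷ rc ∷ rb′ ∷ [] =
  subst (λ b″ → Shape0121 (a ∷ b ∷ c ∷ b″ ∷ []))
        (rank-injective s (there (here refl)) (there (there (there (here refl)))) (trans rb (sym rb′)))
        (shape0121 (ranks⇒< s ra rb z<s) (ranks⇒< s rb rc (s<s z<s)))
red≡0121⇒shape (_ ∷ _ ∷ _ ∷ _ ∷ _ ∷ _) eq with ≡⇒Pointwise-≡ eq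
... | _ ∷ _ ∷ _ ∷ _ ∷ ()
red≡0121⇒shape [] ()
red≡0121⇒shape (_ ∷ []) ()
red≡0121⇒shape (_ ∷ _ ∷ []) ()
red≡0121⇒shape (_ ∷ _ ∷ _ ∷ []) ()

∈-subseqs⁺ : xs ⊆ ys → xs ∈ subseqs ys
∈-subseqs⁺ []                           = here refl
∈-subseqs⁺ (y ∷ʳ xs⊆ys)                 = ∈-++⁺ˡ (∈-subseqs⁺ xs⊆ys)
∈-subseqs⁺ {ys = y ∷ ys} (refl ∷ xs⊆ys) =
  ∈-++⁺ʳ (subseqs ys) (∈-map⁺ (y ∷_) (∈-subseqs⁺ xs⊆ys))

∈-subseqs⁻ : ∀ ys → xs ∈ subseqs ys → xs ⊆ ys
∈-subseqs⁻ []       (here refl) = []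
∈-subseqs⁻ (y ∷ ys) xs∈ with ∈-++⁻ (subseqs ys) xs∈
... | inj₁ xs∈′ = y ∷ʳ ∈-subseqs⁻ ys xs∈′
... | inj₂ xs∈′ with ∈-map⁻ (y ∷_) xs∈′
...   | _ , zs∈ , refl = refl ∷ ∈-subseqs⁻ ys zs∈

eqList-refl : ∀ xs → T (eqList xs xs)
eqList-refl []       = _
eqList-refl (x ∷ xs) = Equivalence.from T-∧ (≡⇒≡ᵇ x x refl , eqList-refl xs)

eqList⇒≡ : ∀ xs ys → T (eqList xs ys) → xs ≡ ys
eqList⇒≡ []       []       _ = refl
eqList⇒≡ (x ∷ xs) (y ∷ ys) t = let x≡ᵇy , eq = Equivalence.to T-∧ t in
  cong₂ _∷_ (≡ᵇ⇒≡ x y x≡ᵇy) (eqList⇒≡ xs ys eq)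

contains⁺ : ∀ {p} → s ⊆ xs → red s ≡ p → T (contains xs p)
contains⁺ {s} s⊆xs refl = any⁺ _ (lose (∈-subseqs⁺ s⊆xs) (eqList-refl (red s)))

contains⁻ : ∀ xs p → T (contains xs p) → ∃[ s ] s ⊆ xs × red s ≡ p
contains⁻ xs p t with find (any⁻ _ (subseqs xs) t)
... | s , s∈ , eq = s , ∈-subseqs⁻ xs s∈ , eqList⇒≡ (red s) p eq

forbidden : List (List ℕ)
forbidden = p0102 ∷ p0121 ∷ []

data Occurrence (xs : List ℕ) : Set where
  occ0102 : s ⊆ xs → Shape0102 s → Occurrence xs
  occ0121 : s ⊆ xs → Shape0121 s → Occurrence xs

avoidsAll-reflects : ∀ xs → Reflects (¬ Occurrence xs) (avoidsAll forbidden xs)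
avoidsAll-reflects xs with contains xs p0102 in c₁ | contains xs p0121 in c₂
... | true | _ = ofⁿ λ none → let s , s⊆xs , eq = contains⁻ xs p0102 (Equivalence.from T-≡ c₁) in
  none (occ0102 s⊆xs (red≡0102⇒shape s eq))
... | false | true = ofⁿ λ none → let s , s⊆xs , eq = contains⁻ xs p0121 (Equivalence.from T-≡ c₂) in
  none (occ0121 s⊆xs (red≡0121⇒shape s eq))
... | false | false = ofʸ λ where
  (occ0102 s⊆xs shape) → subst T c₁ (contains⁺ s⊆xs (red-0102 shape))
  (occ0121 s⊆xs shape) → subst T c₂ (contains⁺ s⊆xs (red-0121 shape))

-- The automaton

-- The states record the shape of the prefix read so far:
-- zeroRun = 0⁺, oneRun = 0⁺1⁺, binaryTail = 0⁺1⁺0{0,1}*,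
-- staircase j = 0⁺1⁺2⁺⋯(2+j)⁺, and zeroTail = a staircase followed by 0⁺.
data State : Set where
  init zeroRun oneRun binaryTail zeroTail dead : State
  staircase : ℕ → State

step : State → ℕ → State
step init          0             = zeroRun
step zeroRun       0             = zeroRun
step zeroRun       1             = oneRun
step oneRun        0             = binaryTail
step oneRun        1             = oneRun
step oneRun        2             = staircase 0
step binaryTail    0             = binaryTail
step binaryTail    1             = binaryTail
step (staircase j) 0             = zeroTail
step (staircase j) (suc (suc y)) =
  if y ≡ᵇ j then staircase j else if y ≡ᵇ suc j then staircase (suc j) else dead
step zeroTail      0             = zeroTail
step _             _             = dead

accepting : State → Bool
accepting dead = false
accepting _    = true

accepts : State → List ℕ → Bool
accepts s []       = accepting s
accepts s (x ∷ xs) = accepts (step s x) xs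

dead-rejects : ∀ xs → ¬ T (accepts dead xs)
dead-rejects []       ()
dead-rejects (_ ∷ xs) = dead-rejects xs

data StaircaseStep (j : ℕ) : ℕ → State → Set where
  stay  : StaircaseStep j j (staircase j)
  climb : StaircaseStep j (suc j) (staircase (suc j))
  drop  : y < j → StaircaseStep j y dead
  leap  : suc j < y → StaircaseStep j y dead

staircase-step : ∀ j y → StaircaseStep j y (step (staircase j) (2 + y))
staircase-step j y with <-cmp y j
... | tri≈ _ refl _ rewrite det (≡ᵇ-reflects-≡ j j) (ofʸ refl) = stay
... | tri< y<j y≢j _
  rewrite det (≡ᵇ-reflects-≡ y j) (ofⁿ y≢j)
        | det (≡ᵇ-reflects-≡ y (suc j)) (ofⁿ (<⇒≢ (m<n⇒m<1+n y<j)))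
  = drop y<j
... | tri> _ y≢j j<y rewrite det (≡ᵇ-reflects-≡ y j) (ofⁿ y≢j) with <-cmp y (suc j)
...   | tri< y<1+j _ _ = contradiction j<y (≤⇒≯ (s≤s⁻¹ y<1+j))
...   | tri≈ _ refl _ rewrite det (≡ᵇ-reflects-≡ j j) (ofʸ refl) = climb
...   | tri> _ y≢1+j 1+j<y rewrite det (≡ᵇ-reflects-≡ y (suc j)) (ofⁿ y≢1+j) = leap 1+j<y

-- ascentCondFrom k l xs: xs may follow a prefix with k ascents and last letter l.
ascentCondFrom : ℕ → ℕ → List ℕ → Bool
ascentCondFrom k l []       = true
ascentCondFrom k l (x ∷ xs) = (x <ᵇ 2 + k) ∧ ascentCondFrom (if l <ᵇ x then suc k else k) x xs

lastOf : ℕ → List ℕ → ℕ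
lastOf x []       = x
lastOf _ (y ∷ ys) = lastOf y ys

lastOf-snoc : ∀ x xs y → lastOf x (xs ++ [ y ]) ≡ y
lastOf-snoc x []       y = refl
lastOf-snoc x (z ∷ xs) y = lastOf-snoc z xs y

asc-snoc : ∀ x xs y →
  asc (x ∷ xs ++ [ y ]) ≡ (if lastOf x xs <ᵇ y then suc (asc (x ∷ xs)) else asc (x ∷ xs))
asc-snoc x [] y with x <ᵇ y
... | true  = refl
... | false = refl
asc-snoc x (z ∷ xs) y rewrite asc-snoc z xs y with lastOf z xs <ᵇ y
... | true  = +-suc _ _
... | false = refl

ascentCond≡ascentCondFrom : ∀ x xs ys →
  ascentCond (x ∷ xs) ys ≡ ascentCondFrom (asc (x ∷ xs)) (lastOf x xs) ys
ascentCond≡ascentCondFrom x xs []       = refl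
ascentCond≡ascentCondFrom x xs (y ∷ ys)
  rewrite ascentCond≡ascentCondFrom x (xs ++ [ y ]) ys | asc-snoc x xs y | lastOf-snoc x xs y = refl

zeroTail-ascent : ∀ k l xs → T (accepts zeroTail xs) → T (ascentCondFrom k l xs)
zeroTail-ascent k l []            _ = _
zeroTail-ascent k l (0 ∷ xs)      t = zeroTail-ascent _ _ xs t
zeroTail-ascent k l (suc _ ∷ xs)  t = contradiction t (dead-rejects xs)

binaryTail-ascent : ∀ k l xs → T (accepts binaryTail xs) → T (ascentCondFrom k l xs)
binaryTail-ascent k l []                 _ = _
binaryTail-ascent k l (0 ∷ xs)           t = binaryTail-ascent _ _ xs t
binaryTail-ascent k l (1 ∷ xs)           t = binaryTail-ascent _ _ xs t
binaryTail-ascent k l (suc (suc _) ∷ xs) t = contradiction t (dead-rejects xs)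

staircase-ascent : ∀ j xs → T (accepts (staircase j) xs) → T (ascentCondFrom (2 + j) (2 + j) xs)
staircase-ascent j []       _ = _
staircase-ascent j (0 ∷ xs) t = zeroTail-ascent _ _ xs t
staircase-ascent j (1 ∷ xs) t = contradiction t (dead-rejects xs)
staircase-ascent j (suc (suc y) ∷ xs) t with step (staircase j) (2 + y) | staircase-step j y
... | _ | stay rewrite det (<ᵇ-reflects-< j j) (ofⁿ (<-irrefl refl)) =
  Equivalence.from T-∧ (<⇒<ᵇ (m<n+m j (z<s {1})) , staircase-ascent j xs t)
... | _ | climb rewrite det (<ᵇ-reflects-< j (suc j)) (ofʸ (n<1+n j)) =
  staircase-ascent (suc j) xs t
... | _ | drop _ = contradiction t (dead-rejects xs)
... | _ | leap _ = contradiction t (dead-rejects xs)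

oneRun-ascent : ∀ xs → T (accepts oneRun xs) → T (ascentCondFrom 1 1 xs)
oneRun-ascent []                       _ = _
oneRun-ascent (0 ∷ xs)                 t = binaryTail-ascent _ _ xs t
oneRun-ascent (1 ∷ xs)                 t = oneRun-ascent xs t
oneRun-ascent (2 ∷ xs)                 t = staircase-ascent 0 xs t
oneRun-ascent (suc (suc (suc _)) ∷ xs) t = contradiction t (dead-rejects xs)

zeroRun-ascent : ∀ xs → T (accepts zeroRun xs) → T (ascentCondFrom 0 0 xs)
zeroRun-ascent []                 _ = _
zeroRun-ascent (0 ∷ xs)           t = zeroRun-ascent xs t
zeroRun-ascent (1 ∷ xs)           t = oneRun-ascent xs t
zeroRun-ascent (suc (suc _) ∷ xs) t = contradiction t (dead-rejects xs)

accepted⇒ascentSeq : ∀ xs → T (accepts init xs) → T (isAscentSeq xs)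
accepted⇒ascentSeq []          _ = _
accepted⇒ascentSeq (0 ∷ xs)     t = subst T (sym (ascentCond≡ascentCondFrom 0 [] xs)) (zeroRun-ascent xs t)
accepted⇒ascentSeq (suc _ ∷ xs) t = contradiction t (dead-rejects xs)

Binary : List ℕ → Set
Binary = All (_≤ 1)

data RiseThenZeros : ℕ → List ℕ → Set where
  allZero : ∀ {m} → All (_≡ 0) xs → RiseThenZeros m xs
  rise    : ∀ {m} → m ≤ x → RiseThenZeros x xs → RiseThenZeros m (x ∷ xs)

Form : State → List ℕ → Set
Form init          xs = Binary xs ⊎ RiseThenZeros 0 xs
Form zeroRun       xs = Binary xs ⊎ RiseThenZeros 0 xs
Form oneRun        xs = Binary xs ⊎ RiseThenZeros 1 xs
Form binaryTail    xs = Binary xs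
Form (staircase j) xs = RiseThenZeros (2 + j) xs
Form zeroTail      xs = All (_≡ 0) xs
Form dead          xs = ⊥

form-∷ : ∀ {m} → x ≤ 1 → m ≤ x →
  Binary xs ⊎ RiseThenZeros x xs → Binary (x ∷ xs) ⊎ RiseThenZeros m (x ∷ xs)
form-∷ x≤1 _   (inj₁ binary) = inj₁ (x≤1 ∷ binary)
form-∷ _   m≤x (inj₂ risen)  = inj₂ (rise m≤x risen)

accepted-form : ∀ s xs → T (accepts s xs) → Form s xs
accepted-form init          []                       _ = inj₁ []
accepted-form zeroRun       []                       _ = inj₁ []
accepted-form oneRun        []                       _ = inj₁ []
accepted-form binaryTail    []                       _ = []
accepted-form (staircase j) []                       _ = allZero []
accepted-form zeroTail      []                       _ = []
accepted-form init          (0 ∷ xs)                 t = form-∷ z≤n z≤n (accepted-form zeroRun xs t)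
accepted-form zeroRun       (0 ∷ xs)                 t = form-∷ z≤n z≤n (accepted-form zeroRun xs t)
accepted-form zeroRun       (1 ∷ xs)                 t = form-∷ ≤-refl z≤n (accepted-form oneRun xs t)
accepted-form oneRun        (0 ∷ xs)                 t = inj₁ (z≤n ∷ accepted-form binaryTail xs t)
accepted-form oneRun        (1 ∷ xs)                 t = form-∷ ≤-refl ≤-refl (accepted-form oneRun xs t)
accepted-form oneRun        (2 ∷ xs)                 t = inj₂ (rise (s≤s z≤n) (accepted-form (staircase 0) xs t))
accepted-form binaryTail    (0 ∷ xs)                 t = z≤n ∷ accepted-form binaryTail xs t
accepted-form binaryTail    (1 ∷ xs)                 t = ≤-refl ∷ accepted-form binaryTail xs t
accepted-form (staircase j) (0 ∷ xs)                 t = allZero (refl ∷ accepted-form zeroTail xs t)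
accepted-form (staircase j) (suc (suc y) ∷ xs)       t with step (staircase j) (2 + y) | staircase-step j y
... | _ | stay   = rise ≤-refl (accepted-form (staircase j) xs t)
... | _ | climb  = rise (n≤1+n _) (accepted-form (staircase (suc j)) xs t)
... | _ | drop _ = contradiction t (dead-rejects xs)
... | _ | leap _ = contradiction t (dead-rejects xs)
accepted-form zeroTail      (0 ∷ xs)                 t = refl ∷ accepted-form zeroTail xs t
accepted-form init          (suc _ ∷ xs)             t = contradiction t (dead-rejects xs)
accepted-form zeroRun       (suc (suc _) ∷ xs)       t = contradiction t (dead-rejects xs)
accepted-form oneRun        (suc (suc (suc _)) ∷ xs) t = contradiction t (dead-rejects xs)
accepted-form binaryTail    (suc (suc _) ∷ xs)       t = contradiction t (dead-rejects xs)
accepted-form (staircase j) (1 ∷ xs)                 t = contradiction t (dead-rejects xs)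
accepted-form zeroTail      (suc _ ∷ xs)             t = contradiction t (dead-rejects xs)
accepted-form dead          xs                       t = contradiction t (dead-rejects xs)

riseThenZeros-lower : ∀ {m n} → m ≤ n → RiseThenZeros n xs → RiseThenZeros m xs
riseThenZeros-lower m≤n (allZero zs)   = allZero zs
riseThenZeros-lower m≤n (rise n≤x r)   = rise (≤-trans m≤n n≤x) r

riseThenZeros-⊆ : ∀ {m} → xs ⊆ ys → RiseThenZeros m ys → RiseThenZeros m xs
riseThenZeros-⊆ σ          (allZero zs)  = allZero (All-resp-⊆ σ zs)
riseThenZeros-⊆ (_ ∷ʳ σ)   (rise m≤y r)  = riseThenZeros-⊆ σ (riseThenZeros-lower m≤y r)
riseThenZeros-⊆ (refl ∷ σ) (rise m≤y r)  = rise m≤y (riseThenZeros-⊆ σ r)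

a<b<c⇒2≤c : a < b → b < c → 2 ≤ c
a<b<c⇒2≤c a<b b<c = ≤-trans (s≤s (≤-trans (s≤s z≤n) a<b)) b<c

binary-no-occurrence : Binary xs → ¬ Occurrence xs
binary-no-occurrence bin (occ0102 σ (shape0102 a<b b<c)) with All-resp-⊆ σ bin
... | _ ∷ _ ∷ _ ∷ c≤1 ∷ [] = <⇒≱ (a<b<c⇒2≤c a<b b<c) c≤1
binary-no-occurrence bin (occ0121 σ (shape0121 a<b b<c)) with All-resp-⊆ σ bin
... | _ ∷ _ ∷ c≤1 ∷ _ = <⇒≱ (a<b<c⇒2≤c a<b b<c) c≤1

riseThenZeros-no-occurrence : RiseThenZeros 0 xs → ¬ Occurrence xs
riseThenZeros-no-occurrence r (occ0102 σ (shape0102 a<b b<c)) with riseThenZeros-⊆ σ r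
... | allZero (_ ∷ refl ∷ _)                    = n≮0 a<b
... | rise _ (allZero (refl ∷ _))               = n≮0 a<b
... | rise _ (rise _ (allZero (_ ∷ refl ∷ _)))  = n≮0 b<c
... | rise _ (rise _ (rise b≤a _))              = <⇒≱ a<b b≤a
riseThenZeros-no-occurrence r (occ0121 σ (shape0121 a<b b<c)) with riseThenZeros-⊆ σ r
... | allZero (_ ∷ refl ∷ _)                          = n≮0 a<b
... | rise _ (allZero (refl ∷ _))                     = n≮0 a<b
... | rise _ (rise _ (allZero (refl ∷ _)))            = n≮0 b<c
... | rise _ (rise _ (rise _ (allZero (refl ∷ _))))   = n≮0 a<b
... | rise _ (rise _ (rise _ (rise c≤b _)))           = <⇒≱ b<c c≤b

accepted⇒no-occurrence : ∀ xs → T (accepts init xs) → ¬ Occurrence xs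
accepted⇒no-occurrence xs t = [ binary-no-occurrence , riseThenZeros-no-occurrence ]′ (accepted-form init xs t)

⊆-extend : ∀ {π pre} → π ⊆ pre → π ++ [ x ] ⊆ pre ++ x ∷ xs
⊆-extend σ = ++⁺ σ (refl ∷ minimum _)

occurrence-extend : ∀ pre x xs → Occurrence ((pre ++ [ x ]) ++ xs) → Occurrence (pre ++ x ∷ xs)
occurrence-extend pre x xs = subst Occurrence (++-assoc pre [ x ] xs)

binaryTail-rejects : ∀ pre xs →
  0 ∷ 1 ∷ 0 ∷ [] ⊆ pre → ¬ T (accepts binaryTail xs) → Occurrence (pre ++ xs)
binaryTail-rejects pre []                 σ r = contradiction _ r
binaryTail-rejects pre (0 ∷ xs)           σ r =
  occurrence-extend pre 0 xs (binaryTail-rejects _ xs (++⁺ʳ _ σ) r)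
binaryTail-rejects pre (1 ∷ xs)           σ r =
  occurrence-extend pre 1 xs (binaryTail-rejects _ xs (++⁺ʳ _ σ) r)
binaryTail-rejects pre (suc (suc _) ∷ xs) σ r = occ0102 (⊆-extend σ) (shape0102 z<s (s<s z<s))

zeroTail-rejects : ∀ pre xs →
  0 ∷ 1 ∷ 2 ∷ 0 ∷ [] ⊆ pre → ¬ T (accepts zeroTail xs) → Occurrence (pre ++ xs)
zeroTail-rejects pre []                 σ r = contradiction _ r
zeroTail-rejects pre (0 ∷ xs)           σ r = occurrence-extend pre 0 xs (zeroTail-rejects _ xs (++⁺ʳ _ σ) r)
zeroTail-rejects pre (1 ∷ xs)           σ r =
  occ0121 (⊆-extend (⊆-trans (refl ∷ refl ∷ refl ∷ 0 ∷ʳ []) σ)) (shape0121 z<s (s<s z<s))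
zeroTail-rejects pre (suc (suc _) ∷ xs) σ r =
  occ0102 (⊆-extend (⊆-trans (refl ∷ refl ∷ 2 ∷ʳ refl ∷ []) σ)) (shape0102 z<s (s<s z<s))

staircase-rejects : ∀ j pre xs →
  (∀ {y} → y ≤ j → 0 ∷ 1 ∷ 2 + y ∷ [] ⊆ pre) →
  (∀ {y} → y < j → 1 ∷ 2 + y ∷ 2 + j ∷ [] ⊆ pre) →
  T (ascentCondFrom (2 + j) (2 + j) xs) → ¬ T (accepts (staircase j) xs) → Occurrence (pre ++ xs)
staircase-rejects j pre []       steps returns asc r = contradiction _ r
staircase-rejects j pre (0 ∷ xs) steps returns asc r =
  occurrence-extend pre 0 xs (zeroTail-rejects _ xs (++⁺ (steps z≤n) (refl ∷ [])) r)
staircase-rejects j pre (1 ∷ xs) steps returns asc r = occ0121 (⊆-extend (steps z≤n)) (shape0121 z<s (s<s z<s))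
staircase-rejects j pre (suc (suc y) ∷ xs) steps returns asc r with step (staircase j) (2 + y) | staircase-step j y
... | _ | stay rewrite det (<ᵇ-reflects-< j j) (ofⁿ (<-irrefl refl)) =
  occurrence-extend pre (2 + j) xs
    (staircase-rejects j _ xs (λ y≤j → ++⁺ʳ _ (steps y≤j)) (λ y<j → ++⁺ʳ _ (returns y<j))
                       (proj₂ (Equivalence.to T-∧ asc)) r)
... | _ | climb rewrite det (<ᵇ-reflects-< j (suc j)) (ofʸ (n<1+n j)) =
  occurrence-extend pre (3 + j) xs (staircase-rejects (suc j) _ xs steps′ returns′ asc r)
  where
  steps′ : ∀ {y} → y ≤ suc j → 0 ∷ 1 ∷ 2 + y ∷ [] ⊆ pre ++ [ 3 + j ]
  steps′ y≤1+j with m≤n⇒m<n∨m≡n y≤1+j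
  ... | inj₁ y<1+j = ++⁺ʳ _ (steps (s≤s⁻¹ y<1+j))
  ... | inj₂ refl  = ++⁺ (⊆-trans (refl ∷ refl ∷ 2 ∷ʳ []) (steps z≤n)) (refl ∷ [])
  returns′ : ∀ {y} → y < suc j → 1 ∷ 2 + y ∷ 3 + j ∷ [] ⊆ pre ++ [ 3 + j ]
  returns′ y<1+j = ++⁺ (∷ˡ⁻ (steps (s≤s⁻¹ y<1+j))) (refl ∷ [])
... | _ | drop y<j = occ0121 (⊆-extend (returns y<j)) (shape0121 (s<s z<s) (s<s (s<s y<j)))
... | _ | leap 1+j<y =
  contradiction 1+j<y (<⇒≱ (s<s⁻¹ (s<s⁻¹ (<ᵇ⇒< _ _ (proj₁ (Equivalence.to T-∧ asc))))))

oneRun-rejects : ∀ pre xs → 0 ∷ 1 ∷ [] ⊆ pre →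
  T (ascentCondFrom 1 1 xs) → ¬ T (accepts oneRun xs) → Occurrence (pre ++ xs)
oneRun-rejects pre []                       σ asc r = contradiction _ r
oneRun-rejects pre (0 ∷ xs)                 σ asc r =
  occurrence-extend pre 0 xs (binaryTail-rejects _ xs (++⁺ σ (refl ∷ [])) r)
oneRun-rejects pre (1 ∷ xs)                 σ asc r =
  occurrence-extend pre 1 xs (oneRun-rejects _ xs (++⁺ʳ _ σ) asc r)
oneRun-rejects pre (2 ∷ xs)                 σ asc r =
  occurrence-extend pre 2 xs (staircase-rejects 0 _ xs (λ { z≤n → ++⁺ σ (refl ∷ []) }) (λ ()) asc r)
oneRun-rejects pre (suc (suc (suc _)) ∷ xs) σ ()  r

zeroRun-rejects : ∀ pre xs → [ 0 ] ⊆ pre →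
  T (ascentCondFrom 0 0 xs) → ¬ T (accepts zeroRun xs) → Occurrence (pre ++ xs)
zeroRun-rejects pre []                 σ asc r = contradiction _ r
zeroRun-rejects pre (0 ∷ xs)           σ asc r =
  occurrence-extend pre 0 xs (zeroRun-rejects _ xs (++⁺ʳ _ σ) asc r)
zeroRun-rejects pre (1 ∷ xs)           σ asc r =
  occurrence-extend pre 1 xs (oneRun-rejects _ xs (++⁺ σ (refl ∷ [])) asc r)
zeroRun-rejects pre (suc (suc _) ∷ xs) σ ()  r

rejected⇒occurrence : ∀ xs → T (isAscentSeq xs) → ¬ T (accepts init xs) → Occurrence xs
rejected⇒occurrence []           _   r = contradiction _ r
rejected⇒occurrence (0 ∷ xs)     asc r =
  zeroRun-rejects [ 0 ] xs (refl ∷ []) (subst T (ascentCond≡ascentCondFrom 0 [] xs) asc) r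
rejected⇒occurrence (suc _ ∷ xs) ()  r

accepts≡ascentSeq∧avoids : ∀ xs → accepts init xs ≡ isAscentSeq xs ∧ avoidsAll forbidden xs
accepts≡ascentSeq∧avoids xs =
  det (fromEquivalence sound complete) (T-reflects (isAscentSeq xs) ×-reflects avoidsAll-reflects xs)
  where
  sound : T (accepts init xs) → T (isAscentSeq xs) × ¬ Occurrence xs
  sound t = accepted⇒ascentSeq xs t , accepted⇒no-occurrence xs t
  complete : T (isAscentSeq xs) × ¬ Occurrence xs → T (accepts init xs)
  complete (asc , none) = decidable-stable (T? _) (λ r → none (rejected⇒occurrence xs asc r))

-- Counting accepted words

count : ℕ → ℕ → State → ℕ
count m k s = length (filterᵇ (accepts s) (words m k))

aP-forbidden≡count : ∀ n → aP forbidden n ≡ count n n init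
aP-forbidden≡count n = cong length (begin
  filterᵇ (avoidsAll forbidden) (filterᵇ isAscentSeq (words n n))
    ≡⟨ filterᵇ-filterᵇ _ _ (words n n) ⟩
  filterᵇ (λ xs → isAscentSeq xs ∧ avoidsAll forbidden xs) (words n n)
    ≡⟨ filterᵇ-cong (sym ∘ accepts≡ascentSeq∧avoids) (words n n) ⟩
  filterᵇ (accepts init) (words n n) ∎)
  where open ≡-Reasoning

count-step : ∀ m k s → count m (suc k) s ≡ sum (applyUpTo (λ x → count m k (step s x)) m)
count-step m k s = begin
  length (filterᵇ (accepts s) (concatMap (λ x → map (x ∷_) (words m k)) (upTo m)))
    ≡⟨ length-filterᵇ-concatMap (accepts s) _ (upTo m) ⟩
  sum (map (λ x → length (filterᵇ (accepts s) (map (x ∷_) (words m k)))) (upTo m))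
    ≡⟨ cong sum (map-cong prepend (upTo m)) ⟩
  sum (map (λ x → count m k (step s x)) (upTo m))
    ≡⟨ cong sum (map-applyUpTo (λ x → x) _ m) ⟩
  sum (applyUpTo (λ x → count m k (step s x)) m) ∎
  where
  open ≡-Reasoning
  prepend : ∀ x → length (filterᵇ (accepts s) (map (x ∷_) (words m k))) ≡ count m k (step s x)
  prepend x = trans (cong length (filterᵇ-map (accepts s) (x ∷_) (words m k)))
                    (length-map (x ∷_) (filterᵇ (λ w → accepts s (x ∷ w)) (words m k)))

count-dead : ∀ m k → count m k dead ≡ 0
count-dead m k = cong length (filter-none (T? ∘ accepts dead) (universal dead-rejects (words m k)))

sum-applyUpTo-zero : ∀ {g : ℕ → ℕ} → (∀ x → g x ≡ 0) → ∀ n → sum (applyUpTo g n) ≡ 0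
sum-applyUpTo-zero g≗0 zero    = refl
sum-applyUpTo-zero {g} g≗0 (suc n) =
  trans (cong (_+ sum (applyUpTo (g ∘ suc) n)) (g≗0 0)) (sum-applyUpTo-zero (g≗0 ∘ suc) n)

sum-two-point : ∀ (F : State → ℕ) → F dead ≡ 0 → ∀ P Q j n → suc j < n →
  sum (applyUpTo (λ y → F (if y ≡ᵇ j then P else if y ≡ᵇ suc j then Q else dead)) n) ≡ F P + F Q
sum-two-point F F-dead P Q zero (suc (suc n)) _ =
  trans (cong (λ rest → F P + (F Q + rest)) (sum-applyUpTo-zero (λ _ → F-dead) n))
        (cong (F P +_) (+-identityʳ (F Q)))
sum-two-point F F-dead P Q zero    (suc zero)    (s≤s ())
sum-two-point F F-dead P Q (suc j) (suc n) (s≤s j<n) =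
  trans (cong (_+ sum (applyUpTo (λ y → F (if y ≡ᵇ j then P else if y ≡ᵇ suc j then Q else dead)) n)) F-dead)
        (sum-two-point F F-dead P Q j n j<n)

staircaseCount : ℕ → ℕ
staircaseCount zero    = 1
staircaseCount (suc k) = 1 + (staircaseCount k + staircaseCount k)

oneRunCount : ℕ → ℕ
oneRunCount zero    = 1
oneRunCount (suc k) = 2 ^ k + (oneRunCount k + staircaseCount k)

zeroRunCount : ℕ → ℕ
zeroRunCount zero    = 1
zeroRunCount (suc k) = zeroRunCount k + oneRunCount k

acceptedCount : State → ℕ → ℕ
acceptedCount init          zero    = 1
acceptedCount init          (suc k) = zeroRunCount k
acceptedCount zeroRun       k       = zeroRunCount k
acceptedCount oneRun        k       = oneRunCount k
acceptedCount binaryTail    k       = 2 ^ k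
acceptedCount (staircase j) k       = staircaseCount k
acceptedCount zeroTail      k       = 1
acceptedCount dead          k       = 0

-- Fits s m k: every letter accepted within k steps from s lies in the alphabet {0, …, m-1}.
Fits : State → ℕ → ℕ → Set
Fits init          m k = k ≤ m
Fits zeroRun       m k = 1 + k ≤ m
Fits oneRun        m k = 2 + k ≤ m
Fits binaryTail    m k = 2 ≤ m
Fits (staircase j) m k = 3 + j + k ≤ m
Fits zeroTail      m k = 1 ≤ m
Fits dead          m k = ⊤

count≡acceptedCount : ∀ k m s → Fits s m k → count m k s ≡ acceptedCount s k
count≡acceptedCount k m dead _ = count-dead m k
count≡acceptedCount zero m init          _ = refl
count≡acceptedCount zero m zeroRun       _ = refl
count≡acceptedCount zero m oneRun        _ = refl
count≡acceptedCount zero m binaryTail    _ = refl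
count≡acceptedCount zero m (staircase j) _ = refl
count≡acceptedCount zero m zeroTail      _ = refl
count≡acceptedCount (suc k) m init fits@(s≤s {n = m′} _)
  rewrite count-step m k init | count≡acceptedCount k m zeroRun fits
        | sum-applyUpTo-zero (λ _ → count-dead m k) m′ = +-identityʳ _
count≡acceptedCount (suc k) m zeroRun fits@(s≤s (s≤s {n = m′} _))
  rewrite count-step m k zeroRun | count≡acceptedCount k m zeroRun (<⇒≤ fits)
        | count≡acceptedCount k m oneRun fits
        | sum-applyUpTo-zero (λ _ → count-dead m k) m′ = cong (zeroRunCount k +_) (+-identityʳ _)
count≡acceptedCount (suc k) m oneRun fits@(s≤s (s≤s (s≤s {n = m′} _)))
  rewrite count-step m k oneRun | count≡acceptedCount k m binaryTail (s≤s (s≤s z≤n))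
        | count≡acceptedCount k m oneRun (<⇒≤ fits) | count≡acceptedCount k m (staircase 0) fits
        | sum-applyUpTo-zero (λ _ → count-dead m k) m′
        = cong (λ n → 2 ^ k + (oneRunCount k + n)) (+-identityʳ _)
count≡acceptedCount (suc k) m binaryTail fits@(s≤s (s≤s {n = m′} _))
  rewrite count-step m k binaryTail | count≡acceptedCount k m binaryTail fits
        | sum-applyUpTo-zero (λ _ → count-dead m k) m′ = refl
count≡acceptedCount (suc k) m zeroTail fits@(s≤s {n = m′} _)
  rewrite count-step m k zeroTail | count≡acceptedCount k m zeroTail fits
        | sum-applyUpTo-zero (λ _ → count-dead m k) m′ = refl
count≡acceptedCount (suc k) m (staircase j) fits@(s≤s (s≤s {n = m′} fits′))
  rewrite count-step m k (staircase j) | count≡acceptedCount k m zeroTail (s≤s z≤n) | count-dead m k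
        | sum-two-point (λ s → count m k s) (count-dead m k) (staircase j) (staircase (suc j)) j m′
            (≤-trans (s≤s (s≤s (m≤m+n j k))) (subst (_≤ m′) (cong suc (+-suc j k)) fits′))
        | count≡acceptedCount k m (staircase j) (≤-trans (+-monoʳ-≤ (3 + j) (n≤1+n k)) fits)
        | count≡acceptedCount k m (staircase (suc j)) (subst (_≤ m) (cong (3 +_) (+-suc j k)) fits) = refl

staircaseCount-closed : ∀ k → staircaseCount k + 1 ≡ 2 * 2 ^ k
staircaseCount-closed zero    = refl
staircaseCount-closed (suc k) = begin
  1 + (f + f) + 1
    ≡⟨ solve 1 (λ f → con 1 :+ (f :+ f) :+ con 1 := (f :+ con 1) :+ (f :+ con 1)) refl f ⟩
  (f + 1) + (f + 1)
    ≡⟨ cong₂ _+_ (staircaseCount-closed k) (staircaseCount-closed k) ⟩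
  2 * 2 ^ k + 2 * 2 ^ k
    ≡⟨ solve 1 (λ p → con 2 :* p :+ con 2 :* p := con 2 :* (con 2 :* p)) refl (2 ^ k) ⟩
  2 * (2 * 2 ^ k) ∎
  where
  open ≡-Reasoning
  f : ℕ
  f = staircaseCount k

oneRunCount-closed : ∀ k → oneRunCount k + k + 2 ≡ 3 * 2 ^ k
oneRunCount-closed zero    = refl
oneRunCount-closed (suc k) = begin
  2 ^ k + (g + f) + suc k + 2
    ≡⟨ solve 4 (λ p g f k → p :+ (g :+ f) :+ (con 1 :+ k) :+ con 2
                          := p :+ (g :+ k :+ con 2) :+ (f :+ con 1)) refl (2 ^ k) g f k ⟩
  2 ^ k + (g + k + 2) + (f + 1)
    ≡⟨ cong₂ (λ a b → 2 ^ k + a + b) (oneRunCount-closed k) (staircaseCount-closed k) ⟩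
  2 ^ k + 3 * 2 ^ k + 2 * 2 ^ k
    ≡⟨ solve 1 (λ p → p :+ con 3 :* p :+ con 2 :* p := con 3 :* (con 2 :* p)) refl (2 ^ k) ⟩
  3 * (2 * 2 ^ k) ∎
  where
  open ≡-Reasoning
  f g : ℕ
  f = staircaseCount k
  g = oneRunCount k

zeroRunCount-closed : ∀ k → 2 * zeroRunCount k + (suc k * suc k + suc k + 2) ≡ 3 * 2 ^ suc k
zeroRunCount-closed zero    = refl
zeroRunCount-closed (suc k) = begin
  2 * (h + g) + (2+k * 2+k + 2+k + 2)
    ≡⟨ solve 3 (λ h g k → con 2 :* (h :+ g) :+ ((con 2 :+ k) :* (con 2 :+ k) :+ (con 2 :+ k) :+ con 2)
                       := (con 2 :* h :+ ((con 1 :+ k) :* (con 1 :+ k) :+ (con 1 :+ k) :+ con 2))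
                          :+ con 2 :* (g :+ k :+ con 2))
             refl h g k ⟩
  (2 * h + (suc k * suc k + suc k + 2)) + 2 * (g + k + 2)
    ≡⟨ cong₂ (λ a b → a + 2 * b) (zeroRunCount-closed k) (oneRunCount-closed k) ⟩
  3 * 2 ^ suc k + 2 * (3 * 2 ^ k)
    ≡⟨ solve 1 (λ p → con 3 :* (con 2 :* p) :+ con 2 :* (con 3 :* p) := con 3 :* (con 2 :* (con 2 :* p)))
             refl (2 ^ k) ⟩
  3 * 2 ^ suc (suc k) ∎
  where
  open ≡-Reasoning
  h g 2+k : ℕ
  h   = zeroRunCount k
  g   = oneRunCount k
  2+k = suc (suc k)

theorem3p5 : (n : ℕ) → 1 Data.Nat.≤ n →
    2 * aP ((0 ∷ 1 ∷ 0 ∷ 2 ∷ []) ∷ (0 ∷ 1 ∷ 2 ∷ 1 ∷ []) ∷ []) n + (n * n + n + 2)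
      ≡ 3 * 2 ^ n
theorem3p5 (suc k) _ = begin
  2 * aP forbidden (suc k) + tail
    ≡⟨ cong (λ a → 2 * a + tail) (aP-forbidden≡count (suc k)) ⟩
  2 * count (suc k) (suc k) init + tail
    ≡⟨ cong (λ a → 2 * a + tail) (count≡acceptedCount (suc k) (suc k) init ≤-refl) ⟩
  2 * zeroRunCount k + tail
    ≡⟨ zeroRunCount-closed k ⟩
  3 * 2 ^ suc k ∎
  where
  open ≡-Reasoning
  tail : ℕ
  tail = suc k * suc k + suc k + 2
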